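{- Neither the palette $\mathcal{P}_{\rm LM}\times\mathrm{sym}(\mathcal{P}_{\rm 3T})$ nor the palette $\mathcal{P}_{\rm 3T}\times\mathrm{sym}(\mathcal{P}_{\rm LM})$ has a homomorphism to the palette $\mathcal{P}_{4/81}$.
   Context: A palette $\mathcal{P}=(C,T)$ consists of a finite nonempty set $C$ of colors and a set $T\subseteq C^3$ of feasible triples. A homomorphism from $(C,T)$ to $(C',T')$ is a map $f:C\to C'$ with $(f(x),f(y),f(z))\in T'$ for all $(x,y,z)\in T$. The product $(C_1,T_1)\times(C_2,T_2)$ has color set $C_1\times C_2$, and $((x_1,x_2),(y_1,y_2),(z_1,z_2))$ is feasible iff $(x_i,y_i,z_i)\in T_i$ for $i=1,2$. The symmetrization $\mathrm{sym}(\mathcal{P})$ of $\mathcal{P}=(C,T)$ has color set $C\cup\{\bar c: c\in C\}$, where $\bar c$ are new colors (clones), and feasible triple set $\bigcup_{(x,y,z)\in T}\{(x,y,z),(\bar x,z,y),(y,x,\bar z),(\bar y,\bar z,x),(z,\bar x,\bar y),(\bar z,\bar y,\bar x)\}$. $\mathcal{P}_{\rm LM}$ is the palette with colors $\{\alpha,\beta',\gamma,\gamma',\omega\}$ and feasible triples $(\alpha,\omega,\gamma)$, $(\omega,\beta',\gamma')$. $\mathcal{P}_{\rm 3T}$ is the palette with colors $\{\alpha,\beta,\beta',\beta'',\gamma'',\omega,\omega'\}$ and feasible triples $(\alpha,\beta,\omega)$, $(\omega,\beta',\omega')$, $(\omega',\beta'',\gamma'')$. $\mathcal{P}_{4/81}$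 is the palette with colors $\{\alpha,\beta,\gamma,\omega\}$ and feasible triples $(\alpha,\beta,\gamma)$, $(\alpha,\beta,\omega)$, $(\omega,\beta,\gamma)$. (Within each palette the listed color names denote distinct colors.) -}

module Defs where

open import Data.Product using (_×_; _,_)

-- A palette: a set of colors together with a predicate of feasible triples.
-- (The paper's palettes are finite and nonempty; the concrete palettes below
-- are finite data types, and finiteness plays no role in the notion of
-- homomorphism.)
record Palette : Set₁ where
  field
    Color    : Set
    Feasible : Color → Color → Color → Set
open Palette public

record Hom (P Q : Palette) : Set where
  field
    map      : Color P → Color Q
    preserve : ∀ x y z → Feasible P x y z →
               Feasible Q (map x) (map y) (map z)

_⊗_ : Palette → Palette → Palette
P ⊗ Q = record
  { Color    = Color P × Color Q
  ; Feasible = λ { (x₁ , x₂) (y₁ , y₂) (z₁ , z₂) →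
                   Feasible P x₁ y₁ z₁ × Feasible Q x₂ y₂ z₂ }
  }

data SymColor (C : Set) : Set where
  orig  : C → SymColor C
  clone : C → SymColor C

data SymFeasible (P : Palette) :
     SymColor (Color P) → SymColor (Color P) → SymColor (Color P) → Set where
  t1 : ∀ {x y z} → Feasible P x y z → SymFeasible P (orig x)  (orig y)  (orig z)
  t2 : ∀ {x y z} → Feasible P x y z → SymFeasible P (clone x) (orig z)  (orig y)
  t3 : ∀ {x y z} → Feasible P x y z → SymFeasible P (orig y)  (orig x)  (clone z)
  t4 : ∀ {x y z} → Feasible P x y z → SymFeasible P (clone y) (clone z) (orig x)
  t5 : ∀ {x y z} → Feasible P x y z → SymFeasible P (orig z)  (clone x) (clone y)
  t6 : ∀ {x y z} → Feasible P x y z → SymFeasible P (clone z) (clone y) (clone x)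

sym : Palette → Palette
sym P = record { Color = SymColor (Color P) ; Feasible = SymFeasible P }

data LMColor : Set where
  α β′ γ γ′ ω : LMColor

data LMFeasible : LMColor → LMColor → LMColor → Set where
  lm1 : LMFeasible α ω γ
  lm2 : LMFeasible ω β′ γ′

P-LM : Palette
P-LM = record { Color = LMColor ; Feasible = LMFeasible }

data TColor : Set where
  α β β′ β″ γ″ ω ω′ : TColor

data TFeasible : TColor → TColor → TColor → Set where
  t3-1 : TFeasible α β ω
  t3-2 : TFeasible ω β′ ω′
  t3-3 : TFeasible ω′ β″ γ″

P-3T : Palette
P-3T = record { Color = TColor ; Feasible = TFeasible }

data FColor : Set where
  α β γ ω : FColor

data FFeasible : FColor → FColor → FColor → Set where
  f1 : FFeasible α β γ
  f2 : FFeasible α β ω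
  f3 : FFeasible ω β γ

P-4/81 : Palette
P-4/81 = record { Color = FColor ; Feasible = FFeasible }

-- A homomorphism carries any configuration of feasible triples to a configuration
-- of the same shape. In P_{4/81} the middle colour of every feasible triple is β,
-- which starts no feasible triple, and the relation "first colour → last colour"
-- (α → γ, α → ω, ω → γ) has no path of length three. But P_LM × sym(P_3T) has a
-- feasible triple whose middle colour starts another one, and P_3T × sym(P_LM)
-- has three feasible triples each starting with the last colour of the previous.
module Submission where

open import Defs
open import Data.Product using (_×_; _,_)
open import Relation.Nullary using (¬_)

data MiddleStarts (P : Palette) : Set where
  middle-starts : ∀ {x y z u v} → Feasible P x y z → Feasible P y u v → MiddleStarts P

data Chain₃ (P : Palette) : Set where
  chain₃ : ∀ {x y z u v s t} →
           Feasible P x y z → Feasible P z u v → Feasible P v s t → Chain₃ P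

module _ {P Q : Palette} (h : Hom P Q) where
  open Hom h

  Hom-MiddleStarts : MiddleStarts P → MiddleStarts Q
  Hom-MiddleStarts (middle-starts p q) =
    middle-starts (preserve _ _ _ p) (preserve _ _ _ q)

  Hom-Chain₃ : Chain₃ P → Chain₃ Q
  Hom-Chain₃ (chain₃ p q r) =
    chain₃ (preserve _ _ _ p) (preserve _ _ _ q) (preserve _ _ _ r)

¬MiddleStarts-4/81 : ¬ MiddleStarts P-4/81
¬MiddleStarts-4/81 (middle-starts f1 ())
¬MiddleStarts-4/81 (middle-starts f2 ())
¬MiddleStarts-4/81 (middle-starts f3 ())

¬Chain₃-4/81 : ¬ Chain₃ P-4/81
¬Chain₃-4/81 (chain₃ f1 () _)
¬Chain₃-4/81 (chain₃ f3 () _)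
¬Chain₃-4/81 (chain₃ f2 f3 ())

MiddleStarts-LM⊗sym3T : MiddleStarts (P-LM ⊗ sym P-3T)
MiddleStarts-LM⊗sym3T = middle-starts (lm1 , t6 t3-3) (lm2 , t4 t3-3)

Chain₃-3T⊗symLM : Chain₃ (P-3T ⊗ sym P-LM)
Chain₃-3T⊗symLM = chain₃ (t3-1 , t6 lm2) (t3-2 , t2 lm2) (t3-3 , t3 lm2)

lemma6p3 : ¬ Hom (P-LM ⊗ sym P-3T) P-4/81 × ¬ Hom (P-3T ⊗ sym P-LM) P-4/81
lemma6p3 =
    (λ h → ¬MiddleStarts-4/81 (Hom-MiddleStarts h MiddleStarts-LM⊗sym3T))
  , (λ h → ¬Chain₃-4/81 (Hom-Chain₃ h Chain₃-3T⊗symLM))
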